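{- For any $n\ge1$ and sequences $X=(x_1,\dots,x_{n-1})$, $Y=(y_1,\dots,y_{n-1})$ of commuting scalars, $$\langle L_n(X),K_n(Y)\rangle=\prod_{i=1}^{n-1}(x_i-y_i).$$
   Context: Identify $\mathbf{Sym}_n$ with the Grassmann algebra on $\eta_1,\dots,\eta_{n-1}$ via $R_I\leftrightarrow\eta_D:=\eta_{d_1}\cdots\eta_{d_k}$ ($R_I$ ribbon basis, $D=\mathrm{Des}(I)=\{d_1<\dots<d_k\}$), and $QSym_n$ with the Grassmann algebra on $\xi_1,\dots,\xi_{n-1}$ via $F_I\leftrightarrow\xi_D:=\xi_{d_1}\cdots\xi_{d_k}$ ($F_I$ fundamental quasi-symmetric functions); the duality pairing is $\langle\xi_D,\eta_E\rangle=\delta_{DE}$, extended bilinearly. $K_n(Z)=(1+z_1\eta_1)\cdots(1+z_{n-1}\eta_{n-1})$ and $L_n(Z)=(z_1-\xi_1)\cdots(z_{n-1}-\xi_{n-1})$. -}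

module Defs where

open import Level using (Level)
open import Data.Nat using (ℕ; zero; suc)
open import Data.Fin using (Fin; zero; suc)
open import Data.Product using (_×_; _,_)
open import Data.List using (List; foldr; map; allFin)
open import Algebra.Bundles using (CommutativeRing)

-- Grassmann (exterior) algebra over a commutative ring R on m generators
-- e₁,…,e_m (anticommuting, eᵢ² = 0), built recursively:
--   G 0 = R,   G (m+1) = G m × G m,
-- where the pair (a , b) stands for  a + e₁ b  and the generators of the
-- inner copy G m are e₂,…,e_{m+1}.  Unfolding, an element of G m is exactly a
-- coefficient family indexed by subsets D = {d₁<…<d_k} ⊆ {1,…,m}, namely the
-- coordinates w.r.t. the standard basis e_D = e_{d₁}⋯e_{d_k}.
module Grassmann {c ℓ : Level} (R : CommutativeRing c ℓ) where
  open CommutativeRing R renaming (Carrier to K)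

  G : ℕ → Set c
  G zero    = K
  G (suc m) = G m × G m

  zeroG : ∀ {m} → G m
  zeroG {zero}  = 0#
  zeroG {suc m} = zeroG {m} , zeroG {m}

  scal : ∀ {m} → K → G m
  scal {zero}  r = r
  scal {suc m} r = scal {m} r , zeroG {m}

  oneG : ∀ {m} → G m
  oneG {m} = scal {m} 1#

  _+G_ : ∀ {m} → G m → G m → G m
  _+G_ {zero}  r s = r + s
  _+G_ {suc m} (a , b) (c , d) = _+G_ {m} a c , _+G_ {m} b d

  negG : ∀ {m} → G m → G m
  negG {zero}  r = - r
  negG {suc m} (a , b) = negG {m} a , negG {m} b

  _-G_ : ∀ {m} → G m → G m → G m
  _-G_ {m} x y = _+G_ {m} x (negG {m} y)

  -- grade involution (e_D ↦ (-1)^{|D|} e_D)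
  invol : ∀ {m} → G m → G m
  invol {zero}  r = r
  invol {suc m} (a , b) = invol {m} a , negG {m} (invol {m} b)

  -- Grassmann product: (a + e₁ b)(c + e₁ d) = a c + e₁ (b c + â d)
  _*G_ : ∀ {m} → G m → G m → G m
  _*G_ {zero}  r s = r * s
  _*G_ {suc m} (a , b) (c , d) = _*G_ {m} a c , _+G_ {m} (_*G_ {m} b c) (_*G_ {m} (invol {m} a) d)

  -- the generator e_{i+1} (i : Fin m, 0-based)
  gen : ∀ {m} → Fin m → G m
  gen {suc m} zero    = zeroG {m} , oneG {m}
  gen {suc m} (suc i) = gen {m} i , zeroG {m}

  prodG : ∀ {m} → (Fin m → G m) → G m
  prodG {m} f = foldr (_*G_ {m}) (oneG {m}) (map f (allFin m))

  prodR : ∀ {m} → (Fin m → K) → K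
  prodR {m} f = foldr _*_ 1# (map f (allFin m))

  -- duality pairing ⟨ξ_D, η_E⟩ = δ_{DE}, extended bilinearly
  pair : ∀ {m} → G m → G m → K
  pair {zero}  r s = r * s
  pair {suc m} (a , b) (c , d) = pair {m} a c + pair {m} b d

  -- K_n(Z) = (1 + z₁η₁)⋯(1 + z_{n-1}η_{n-1}),  in Sym_n ≅ G (n-1)
  Kn : ∀ {m} → (Fin m → K) → G m
  Kn {m} Z = prodG {m} (λ i → _+G_ {m} (oneG {m}) (_*G_ {m} (scal {m} (Z i)) (gen {m} i)))

  -- L_n(Z) = (z₁ - ξ₁)⋯(z_{n-1} - ξ_{n-1}),  in QSym_n ≅ G (n-1)
  Ln : ∀ {m} → (Fin m → K) → G m
  Ln {m} Z = prodG {m} (λ i → _-G_ {m} (scal {m} (Z i)) (gen {m} i))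

-- Split off the first generator: G (m+1) = G m ⊕ e₁ G m.  Every factor of L_n
-- and K_n except the first lies in the inner copy G m, so
--   L_n(X) = (x₁ − e₁) · L'  and  K_n(Y) = (1 + y₁ e₁) · K',
-- with L' = L_{n-1}(x₂,…) and K' = K_{n-1}(y₂,…).  In coordinates these are
-- (x₁ L' , −L') and (K' , y₁ K'), and the pairing is taken componentwise, so
-- ⟨L_n(X), K_n(Y)⟩ = x₁⟨L',K'⟩ − y₁⟨L',K'⟩ = (x₁ − y₁)⟨L',K'⟩; induct.
module Submission where

open import Defs
open import Level using (Level)
open import Data.Nat using (ℕ; _≤_; _∸_; zero; suc)
open import Data.Fin using (Fin; zero; suc)
open import Data.Product using (_×_; _,_)
open import Data.List using (List; []; _∷_; foldr; map; allFin)
open import Data.List.Properties using (map-tabulate)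
open import Function using (_∘_; id)
open import Algebra.Bundles using (CommutativeRing)
open import Relation.Binary.Bundles using (Setoid)
open import Relation.Binary.PropositionalEquality as ≡ using (_≡_)
import Algebra.Properties.Ring as RingProperties
import Algebra.Properties.CommutativeSemigroup as CommutativeSemigroupProperties
import Relation.Binary.Reasoning.Setoid as SetoidReasoning

foldr-map-allFin-suc : ∀ {a b} {A : Set a} {B : Set b} (_∙_ : A → B → B) (e : B)
  m (f : Fin (suc m) → A) →
  foldr _∙_ e (map f (allFin (suc m))) ≡ f zero ∙ foldr _∙_ e (map (f ∘ suc) (allFin m))
foldr-map-allFin-suc _∙_ e m f =
  ≡.cong (λ xs → foldr _∙_ e (f zero ∷ xs))
         (≡.trans (map-tabulate suc f) (≡.sym (map-tabulate id (f ∘ suc))))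

module GrassmannProperties {c ℓ : Level} (R : CommutativeRing c ℓ) where
  open CommutativeRing R renaming (Carrier to K) hiding (zero)
  open Grassmann R
  open RingProperties ring using (-0#≈0#; -1*x≈-x)
  open CommutativeSemigroupProperties *-commutativeSemigroup using (interchange)

  infix 4 _≈G_
  _≈G_ : ∀ {m} → G m → G m → Set ℓ
  _≈G_ {zero}  r s = r ≈ s
  _≈G_ {suc m} (a , b) (c , d) = _≈G_ {m} a c × _≈G_ {m} b d

  ≈G-refl : ∀ {m} {a : G m} → _≈G_ {m} a a
  ≈G-refl {zero}  = refl
  ≈G-refl {suc m} = ≈G-refl {m} , ≈G-refl {m}

  ≈G-sym : ∀ {m} {a b : G m} → _≈G_ {m} a b → _≈G_ {m} b a
  ≈G-sym {zero}  p = sym p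
  ≈G-sym {suc m} (p , q) = ≈G-sym {m} p , ≈G-sym {m} q

  ≈G-trans : ∀ {m} {a b d : G m} → _≈G_ {m} a b → _≈G_ {m} b d → _≈G_ {m} a d
  ≈G-trans {zero}  p q = trans p q
  ≈G-trans {suc m} (p , q) (p′ , q′) = ≈G-trans {m} p p′ , ≈G-trans {m} q q′

  G-setoid : ℕ → Setoid c ℓ
  G-setoid m = record
    { Carrier       = G m
    ; _≈_           = _≈G_ {m}
    ; isEquivalence = record { refl = ≈G-refl {m} ; sym = ≈G-sym {m} ; trans = ≈G-trans {m} }
    }

  module G-Reasoning (m : ℕ) = SetoidReasoning (G-setoid m)

  +G-cong : ∀ {m} {a b a′ b′ : G m} → _≈G_ {m} a a′ → _≈G_ {m} b b′ →
    _≈G_ {m} (_+G_ {m} a b) (_+G_ {m} a′ b′)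
  +G-cong {zero}  p q = +-cong p q
  +G-cong {suc m} (p , q) (p′ , q′) = +G-cong {m} p p′ , +G-cong {m} q q′

  negG-cong : ∀ {m} {a a′ : G m} → _≈G_ {m} a a′ → _≈G_ {m} (negG {m} a) (negG {m} a′)
  negG-cong {zero}  p = -‿cong p
  negG-cong {suc m} (p , q) = negG-cong {m} p , negG-cong {m} q

  invol-cong : ∀ {m} {a a′ : G m} → _≈G_ {m} a a′ → _≈G_ {m} (invol {m} a) (invol {m} a′)
  invol-cong {zero}  p = p
  invol-cong {suc m} (p , q) = invol-cong {m} p , negG-cong {m} (invol-cong {m} q)

  *G-cong : ∀ {m} {a b a′ b′ : G m} → _≈G_ {m} a a′ → _≈G_ {m} b b′ →
    _≈G_ {m} (_*G_ {m} a b) (_*G_ {m} a′ b′)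
  *G-cong {zero}  p q = *-cong p q
  *G-cong {suc m} (p , q) (p′ , q′) =
    *G-cong {m} p p′ , +G-cong {m} (*G-cong {m} q p′) (*G-cong {m} (invol-cong {m} p) q′)

  +G-identityˡ : ∀ {m} (a : G m) → _≈G_ {m} (_+G_ {m} (zeroG {m}) a) a
  +G-identityˡ {zero}  a = +-identityˡ a
  +G-identityˡ {suc m} (a , b) = +G-identityˡ {m} a , +G-identityˡ {m} b

  +G-identityʳ : ∀ {m} (a : G m) → _≈G_ {m} (_+G_ {m} a (zeroG {m})) a
  +G-identityʳ {zero}  a = +-identityʳ a
  +G-identityʳ {suc m} (a , b) = +G-identityʳ {m} a , +G-identityʳ {m} b

  negG-zero : ∀ {m} → _≈G_ {m} (negG {m} (zeroG {m})) (zeroG {m})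
  negG-zero {zero}  = -0#≈0#
  negG-zero {suc m} = negG-zero {m} , negG-zero {m}

  negG-scal : ∀ {m} (r : K) → _≈G_ {m} (negG {m} (scal {m} r)) (scal {m} (- r))
  negG-scal {zero}  r = refl
  negG-scal {suc m} r = negG-scal {m} r , negG-zero {m}

  invol-zero : ∀ {m} → _≈G_ {m} (invol {m} (zeroG {m})) (zeroG {m})
  invol-zero {zero}  = refl
  invol-zero {suc m} = invol-zero {m} , ≈G-trans {m} (negG-cong {m} (invol-zero {m})) (negG-zero {m})

  invol-scal : ∀ {m} (r : K) → _≈G_ {m} (invol {m} (scal {m} r)) (scal {m} r)
  invol-scal {zero}  r = refl
  invol-scal {suc m} r = invol-scal {m} r , ≈G-trans {m} (negG-cong {m} (invol-zero {m})) (negG-zero {m})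

  *G-zeroˡ : ∀ {m} (a : G m) → _≈G_ {m} (_*G_ {m} (zeroG {m}) a) (zeroG {m})
  *G-zeroˡ {zero}  a = zeroˡ a
  *G-zeroˡ {suc m} (a , b) = *G-zeroˡ {m} a ,
    ≈G-trans {m} (+G-cong {m} (*G-zeroˡ {m} a)
                              (≈G-trans {m} (*G-cong {m} (invol-zero {m}) (≈G-refl {m})) (*G-zeroˡ {m} b)))
                 (+G-identityˡ {m} _)

  *G-zeroʳ : ∀ {m} (a : G m) → _≈G_ {m} (_*G_ {m} a (zeroG {m})) (zeroG {m})
  *G-zeroʳ {zero}  a = zeroʳ a
  *G-zeroʳ {suc m} (a , b) = *G-zeroʳ {m} a ,
    ≈G-trans {m} (+G-cong {m} (*G-zeroʳ {m} b) (*G-zeroʳ {m} (invol {m} a))) (+G-identityˡ {m} _)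

  *G-identityʳ : ∀ {m} (a : G m) → _≈G_ {m} (_*G_ {m} a (oneG {m})) a
  *G-identityʳ {zero}  a = *-identityʳ a
  *G-identityʳ {suc m} (a , b) = *G-identityʳ {m} a ,
    ≈G-trans {m} (+G-cong {m} (*G-identityʳ {m} b) (*G-zeroʳ {m} (invol {m} a))) (+G-identityʳ {m} b)

  smul : ∀ {m} → K → G m → G m
  smul {zero}  r a = r * a
  smul {suc m} r (a , b) = smul {m} r a , smul {m} r b

  scal-*G : ∀ {m} (r : K) (a : G m) → _≈G_ {m} (_*G_ {m} (scal {m} r) a) (smul {m} r a)
  scal-*G {zero}  r a = refl
  scal-*G {suc m} r (a , b) = scal-*G {m} r a ,
    ≈G-trans {m} (+G-cong {m} (*G-zeroˡ {m} a)
                              (≈G-trans {m} (*G-cong {m} (invol-scal {m} r) (≈G-refl {m})) (scal-*G {m} r b)))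
                 (+G-identityˡ {m} _)

  inner : ∀ {m} → G m → G (suc m)
  inner {m} a = a , zeroG {m}

  inner-+G : ∀ {m} (a b : G m) →
    _≈G_ {suc m} (_+G_ {suc m} (inner {m} a) (inner {m} b)) (inner {m} (_+G_ {m} a b))
  inner-+G {m} a b = ≈G-refl {m} , +G-identityˡ {m} (zeroG {m})

  inner-negG : ∀ {m} (a : G m) → _≈G_ {suc m} (negG {suc m} (inner {m} a)) (inner {m} (negG {m} a))
  inner-negG {m} a = ≈G-refl {m} , negG-zero {m}

  inner-*G : ∀ {m} (a b : G m) →
    _≈G_ {suc m} (_*G_ {suc m} (inner {m} a) (inner {m} b)) (inner {m} (_*G_ {m} a b))
  inner-*G {m} a b = ≈G-refl {m} ,
    ≈G-trans {m} (+G-cong {m} (*G-zeroˡ {m} b) (*G-zeroʳ {m} (invol {m} a))) (+G-identityˡ {m} _)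

  scal-pair-*G-inner : ∀ {m} (r s : K) (a : G m) →
    _≈G_ {suc m} (_*G_ {suc m} (scal {m} r , scal {m} s) (inner {m} a)) (smul {m} r a , smul {m} s a)
  scal-pair-*G-inner {m} r s a = scal-*G {m} r a ,
    ≈G-trans {m} (+G-cong {m} (scal-*G {m} s a) (*G-zeroʳ {m} _)) (+G-identityʳ {m} _)

  foldr-*G-inner : ∀ {m} {a} {A : Set a} (f : A → G (suc m)) (u : A → G m) →
    (∀ x → _≈G_ {suc m} (f x) (inner {m} (u x))) → (xs : List A) →
    _≈G_ {suc m} (foldr (_*G_ {suc m}) (oneG {suc m}) (map f xs))
                 (inner {m} (foldr (_*G_ {m}) (oneG {m}) (map u xs)))
  foldr-*G-inner {m} f u f≈ []       = ≈G-refl {suc m}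
  foldr-*G-inner {m} f u f≈ (x ∷ xs) =
    ≈G-trans {suc m} (*G-cong {suc m} (f≈ x) (foldr-*G-inner {m} f u f≈ xs)) (inner-*G {m} _ _)

  prodG-suc : ∀ {m} (f : Fin (suc m) → G (suc m)) (u : Fin m → G m) →
    (∀ i → _≈G_ {suc m} (f (suc i)) (inner {m} (u i))) →
    _≈G_ {suc m} (prodG {suc m} f) (_*G_ {suc m} (f zero) (inner {m} (prodG {m} u)))
  prodG-suc {m} f u f≈ = begin
    prodG {suc m} f
      ≡⟨ foldr-map-allFin-suc (_*G_ {suc m}) (oneG {suc m}) m f ⟩
    _*G_ {suc m} (f zero) (foldr (_*G_ {suc m}) (oneG {suc m}) (map (f ∘ suc) (allFin m)))
      ≈⟨ *G-cong {suc m} (≈G-refl {suc m}) (foldr-*G-inner {m} (f ∘ suc) u f≈ (allFin m)) ⟩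
    _*G_ {suc m} (f zero) (inner {m} (prodG {m} u)) ∎
    where open G-Reasoning (suc m)

  Ln-factor-inner : ∀ {m} (r : K) (i : Fin m) →
    _≈G_ {suc m} (_-G_ {suc m} (scal {suc m} r) (gen {suc m} (suc i)))
                 (inner {m} (_-G_ {m} (scal {m} r) (gen {m} i)))
  Ln-factor-inner {m} r i =
    ≈G-trans {suc m} (+G-cong {suc m} (≈G-refl {suc m}) (inner-negG {m} (gen {m} i))) (inner-+G {m} _ _)

  Kn-factor-inner : ∀ {m} (r : K) (i : Fin m) →
    _≈G_ {suc m} (_+G_ {suc m} (oneG {suc m}) (_*G_ {suc m} (scal {suc m} r) (gen {suc m} (suc i))))
                 (inner {m} (_+G_ {m} (oneG {m}) (_*G_ {m} (scal {m} r) (gen {m} i))))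
  Kn-factor-inner {m} r i =
    ≈G-trans {suc m} (+G-cong {suc m} (≈G-refl {suc m}) (inner-*G {m} _ _)) (inner-+G {m} _ _)

  Ln-factor-zero : ∀ {m} (r : K) →
    _≈G_ {suc m} (_-G_ {suc m} (scal {suc m} r) (gen {suc m} zero)) (scal {m} r , scal {m} (- 1#))
  Ln-factor-zero {m} r =
    ≈G-trans {m} (+G-cong {m} (≈G-refl {m}) (negG-zero {m})) (+G-identityʳ {m} _) ,
    ≈G-trans {m} (+G-identityˡ {m} _) (negG-scal {m} 1#)

  Kn-factor-zero : ∀ {m} (r : K) →
    _≈G_ {suc m} (_+G_ {suc m} (oneG {suc m}) (_*G_ {suc m} (scal {suc m} r) (gen {suc m} zero)))
                 (scal {m} 1# , scal {m} r)
  Kn-factor-zero {m} r =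
    ≈G-trans {m} (+G-cong {m} (≈G-refl {m}) (*G-zeroʳ {m} _)) (+G-identityʳ {m} _) ,
    ≈G-trans {m} (+G-identityˡ {m} _)
      (≈G-trans {m} (+G-cong {m} (*G-zeroˡ {m} _) (≈G-trans {m} (*G-identityʳ {m} _) (invol-scal {m} r)))
                    (+G-identityˡ {m} _))

  Ln-suc : ∀ {m} (X : Fin (suc m) → K) →
    _≈G_ {suc m} (Ln {suc m} X) (smul {m} (X zero) (Ln {m} (X ∘ suc)) , smul {m} (- 1#) (Ln {m} (X ∘ suc)))
  Ln-suc {m} X = begin
    Ln {suc m} X
      ≈⟨ prodG-suc {m} _ _ (λ i → Ln-factor-inner {m} (X (suc i)) i) ⟩
    _*G_ {suc m} (_-G_ {suc m} (scal {suc m} (X zero)) (gen {suc m} zero)) (inner {m} (Ln {m} (X ∘ suc)))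
      ≈⟨ *G-cong {suc m} (Ln-factor-zero {m} (X zero)) (≈G-refl {suc m}) ⟩
    _*G_ {suc m} (scal {m} (X zero) , scal {m} (- 1#)) (inner {m} (Ln {m} (X ∘ suc)))
      ≈⟨ scal-pair-*G-inner {m} (X zero) (- 1#) (Ln {m} (X ∘ suc)) ⟩
    smul {m} (X zero) (Ln {m} (X ∘ suc)) , smul {m} (- 1#) (Ln {m} (X ∘ suc)) ∎
    where open G-Reasoning (suc m)

  Kn-suc : ∀ {m} (Y : Fin (suc m) → K) →
    _≈G_ {suc m} (Kn {suc m} Y) (smul {m} 1# (Kn {m} (Y ∘ suc)) , smul {m} (Y zero) (Kn {m} (Y ∘ suc)))
  Kn-suc {m} Y = begin
    Kn {suc m} Y
      ≈⟨ prodG-suc {m} _ _ (λ i → Kn-factor-inner {m} (Y (suc i)) i) ⟩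
    _*G_ {suc m} (_+G_ {suc m} (oneG {suc m}) (_*G_ {suc m} (scal {suc m} (Y zero)) (gen {suc m} zero)))
                 (inner {m} (Kn {m} (Y ∘ suc)))
      ≈⟨ *G-cong {suc m} (Kn-factor-zero {m} (Y zero)) (≈G-refl {suc m}) ⟩
    _*G_ {suc m} (scal {m} 1# , scal {m} (Y zero)) (inner {m} (Kn {m} (Y ∘ suc)))
      ≈⟨ scal-pair-*G-inner {m} 1# (Y zero) (Kn {m} (Y ∘ suc)) ⟩
    smul {m} 1# (Kn {m} (Y ∘ suc)) , smul {m} (Y zero) (Kn {m} (Y ∘ suc)) ∎
    where open G-Reasoning (suc m)

  pair-cong : ∀ {m} {a b a′ b′ : G m} → _≈G_ {m} a a′ → _≈G_ {m} b b′ → pair {m} a b ≈ pair {m} a′ b′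
  pair-cong {zero}  p q = *-cong p q
  pair-cong {suc m} (p , q) (p′ , q′) = +-cong (pair-cong {m} p p′) (pair-cong {m} q q′)

  pair-smul : ∀ {m} (r s : K) (a b : G m) → pair {m} (smul {m} r a) (smul {m} s b) ≈ (r * s) * pair {m} a b
  pair-smul {zero}  r s a b = interchange r a s b
  pair-smul {suc m} r s (a , a′) (b , b′) =
    trans (+-cong (pair-smul {m} r s a b) (pair-smul {m} r s a′ b′)) (sym (distribˡ (r * s) _ _))

  pair-Ln-Kn : ∀ m (X Y : Fin m → K) → pair {m} (Ln {m} X) (Kn {m} Y) ≈ prodR {m} (λ i → X i - Y i)
  pair-Ln-Kn zero    X Y = *-identityˡ 1#
  pair-Ln-Kn (suc m) X Y = begin
    pair {suc m} (Ln {suc m} X) (Kn {suc m} Y)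
      ≈⟨ pair-cong {suc m} (Ln-suc {m} X) (Kn-suc {m} Y) ⟩
    pair {m} (smul {m} x L′) (smul {m} 1# K′) + pair {m} (smul {m} (- 1#) L′) (smul {m} y K′)
      ≈⟨ +-cong (pair-smul {m} x 1# L′ K′) (pair-smul {m} (- 1#) y L′ K′) ⟩
    (x * 1#) * pair {m} L′ K′ + (- 1# * y) * pair {m} L′ K′
      ≈⟨ sym (distribʳ (pair {m} L′ K′) _ _) ⟩
    (x * 1# + - 1# * y) * pair {m} L′ K′
      ≈⟨ *-cong (+-cong (*-identityʳ x) (-1*x≈-x y)) (pair-Ln-Kn m (X ∘ suc) (Y ∘ suc)) ⟩
    (x - y) * prodR {m} (λ i → X (suc i) - Y (suc i))
      ≡⟨ ≡.sym (foldr-map-allFin-suc _*_ 1# m (λ i → X i - Y i)) ⟩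
    prodR {suc m} (λ i → X i - Y i) ∎
    where
      open SetoidReasoning setoid
      x = X zero
      y = Y zero
      L′ = Ln {m} (X ∘ suc)
      K′ = Kn {m} (Y ∘ suc)

mainTheorem11 : ∀ {c ℓ : Level} (R : CommutativeRing c ℓ) (n : ℕ) → 1 ≤ n →
    (X Y : Fin (n ∸ 1) → CommutativeRing.Carrier R) →
    CommutativeRing._≈_ R
      (Grassmann.pair R {n ∸ 1} (Grassmann.Ln R {n ∸ 1} X) (Grassmann.Kn R {n ∸ 1} Y))
      (Grassmann.prodR R {n ∸ 1} (λ i → CommutativeRing._-_ R (X i) (Y i)))
mainTheorem11 R n _ X Y = GrassmannProperties.pair-Ln-Kn R (n ∸ 1) X Y
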